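{- Let $n$ be a natural number and $k$ a positive integer. Let $\mathcal{D}_n=\{2^{n-m}\cdot\mathsf{C}_{2^m}: 0\le m\le n,\ m\text{ even}\}$ and $\mathcal{D}_n'=\{2^{n-m}\cdot\mathsf{C}_{2^m}: 0\le m\le n,\ m\text{ odd}\}$. Then $\mathcal{D}_n$ and $\mathcal{D}_n'$ can be separated by a non-adaptive left $k$-query algorithm over $\mathbb{N}$ if and only if $k\ge n$.
   Context: Digraphs are finite structures $(V,R)$ with $V\neq\varnothing$ and $R\subseteq V\times V$; $\hom(F,D)$ is the number of homomorphisms from $F$ to $D$. $\mathsf{C}_p$ is the directed cycle of length $p$ (vertices $0,\dots,p-1$, edges $(i,i+1 \bmod p)$), and $r\cdot H$ is the disjoint union of $r$ copies of $H$. A non-adaptive left $k$-query algorithm over $\mathbb{N}$ is a pair $((F_1,\dots,F_k),X)$ with $F_i$ digraphs and $X\subseteq\mathbb{N}^k$; it accepts a digraph $D$ iff $(\hom(F_1,D),\dots,\hom(F_k,D))\in X$, and rejects it otherwise. An algorithm separates classes $\mathcal{A},\mathcal{B}$ if it accepts all structures in $\mathcal{A}$ and rejects all in $\mathcal{B}$, or vice versa. -}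

module Defs where

open import Data.Nat using (ℕ; zero; suc; _+_; _*_; _∸_; _^_; _≤_; _<_; _%_)
open import Data.Nat.Properties using (m^n>0)
open import Data.Nat.Divisibility using (_∣_)
open import Data.Fin using (Fin; toℕ; fromℕ<; combine; remQuot)
open import Data.Fin.Properties using () renaming (_≟_ to _≟ᶠ_)
open import Data.Bool using (Bool; true; false; _∧_; _∨_; not)
open import Data.List using (List; []; _∷_; [_]; map; concatMap; filter; length; allFin; foldr)
open import Data.Vec using (Vec; lookup)
import Data.Vec as Vec
open import Data.Product using (Σ; _×_; _,_; proj₁; proj₂)
open import Data.Sum using (_⊎_)
open import Relation.Nullary using (¬_)
open import Relation.Nullary.Decidable using (⌊_⌋)
open import Relation.Binary.PropositionalEquality using (_≡_)
import Data.Nat as ℕ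

-- A (finite) digraph: vertex set Fin size, edge relation given as a Boolean
-- matrix, and a witness vertex (so V ≠ ∅).
record Digraph : Set where
  field
    size     : ℕ
    edge     : Fin size → Fin size → Bool
    aVertex  : Fin size
open Digraph public

cycle : (p : ℕ) → Fin p → Digraph
cycle p v = record
  { size    = p
  ; edge    = λ i j → ⌊ toℕ j ℕ.≟ (suc (toℕ i) % p) {{nz i}} ⌋
  ; aVertex = v }
  where
  nz : Fin p → ℕ.NonZero p
  nz Fin.zero    = _
  nz (Fin.suc _) = _

-- disjoint union r · H of r copies of H (r ≥ 1, witnessed by an element of Fin r);
-- vertex u of r · H lies in copy proj₁ (remQuot _ u) at vertex proj₂ (remQuot _ u).
_·_ : {r : ℕ} → Fin r → Digraph → Digraph
_·_ {r} c H = record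
  { size    = r * size H
  ; edge    = λ u v →
      let (a , x) = remQuot {r} (size H) u
          (b , y) = remQuot {r} (size H) v
      in ⌊ a ≟ᶠ b ⌋ ∧ edge H x y
  ; aVertex = combine c (aVertex H) }

allMaps : (a b : ℕ) → List (Vec (Fin b) a)
allMaps zero    b = [ Vec.[] ]
allMaps (suc a) b = concatMap (λ f → map (Vec._∷ f) (allFin b)) (allMaps a b)

all : {A : Set} → (A → Bool) → List A → Bool
all p = foldr (λ x b → p x ∧ b) true

isHom : (F D : Digraph) → Vec (Fin (size D)) (size F) → Bool
isHom F D f =
  all (λ i → all (λ j → not (edge F i j) ∨ edge D (lookup f i) (lookup f j))
                 (allFin (size F)))
      (allFin (size F))

hom : Digraph → Digraph → ℕ
hom F D = length (filter (λ f → isHom F D f ≡? true) (allMaps (size F) (size D)))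
  where
  open import Data.Bool.Properties using () renaming (_≟_ to _≡?_)

-- non-adaptive left k-query algorithm over ℕ: queries F₁..F_k and X ⊆ ℕ^k
record Algorithm (k : ℕ) : Set₁ where
  field
    queries : Vec Digraph k
    accSet  : Vec ℕ k → Set
open Algorithm public

Accepts : {k : ℕ} → Algorithm k → Digraph → Set
Accepts A D = accSet A (Vec.map (λ F → hom F D) (queries A))

Separates : {k : ℕ} → Algorithm k → (Digraph → Set) → (Digraph → Set) → Set
Separates A 𝒜 ℬ =
  ((∀ D → 𝒜 D → Accepts A D) × (∀ D → ℬ D → ¬ Accepts A D))
  ⊎ ((∀ D → 𝒜 D → ¬ Accepts A D) × (∀ D → ℬ D → Accepts A D))

zero2^ : (e : ℕ) → Fin (2 ^ e)
zero2^ e = fromℕ< (m^n>0 2 e)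

D[_,_] : (n m : ℕ) → Digraph
D[ n , m ] = zero2^ (n ∸ m) · cycle (2 ^ m) (zero2^ m)

𝒟 : ℕ → Digraph → Set
𝒟 n D = Σ ℕ λ m → m ≤ n × 2 ∣ m × D ≡ D[ n , m ]

𝒟′ : ℕ → Digraph → Set
𝒟′ n D = Σ ℕ λ m → m ≤ n × ¬ (2 ∣ m) × D ≡ D[ n , m ]

module Submission where

-- If F has a homomorphism f₀ into s · C_p, then subtracting f₀ pointwise (inside each
-- copy, modulo p) is a bijection from the homomorphisms F → s · C_p onto the maps from F
-- to s p loops that are constant along edges.  Hence hom(F, D_m), where
-- D_m = 2^(n-m) · C_(2^m), is either 0 or a number independent of m.  Reduction modulo
-- 2^a maps D_b into D_a for a ≤ b, so the m with hom(F, D_m) > 0 form an initial segment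
-- and each query changes its value between D_m and D_(m+1) for at most one m.  A
-- separating algorithm must see such a change for every m < n (D_m and D_(m+1) have
-- opposite parity), which gives an injection from {0, …, n-1} into the queries.
-- Conversely the queries C_(2^a), a < k, determine m ≤ n, because C_(2^a) maps into D_m
-- iff 2^m divides 2^a.

open import Defs
import Data.Nat as ℕ
open import Data.Nat
  using (ℕ; zero; suc; _+_; _*_; _∸_; _^_; _≤_; _<_; z≤n; s≤s; NonZero; _%_; >-nonZero⁻¹)
open import Data.Nat.Properties
  using ( +-comm; +-assoc; +-suc; m∸n+n≡m; m+[n∸m]≡n; <⇒≤; ≤-trans; <-trans; <-≤-trans; n≤1+n
        ; <-cmp; ≮⇒≥; n≤0⇒n≡0; m^n≢0; ^-distribˡ-+-*; ^-monoʳ-<)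
open import Data.Nat.Divisibility
  using (_∣_; _∤_; divides; ∣1⇒≡1; ∣m+n∣m⇒∣n; ∣m∣n⇒∣m+n; m%n≡0⇒n∣m; >⇒∤)
open import Data.Nat.DivMod
  using (_mod_; m%n<n; m%n%n≡m%n; %-distribˡ-+; [m+n]%n≡m%n; m<n⇒m%n≡m; m∣n⇒o%n%m≡o%m)
import Data.Fin as Fin
open import Data.Fin using (Fin; toℕ; fromℕ<; combine; remQuot)
open import Data.Fin.Properties
  using ( toℕ-fromℕ<; toℕ-injective; toℕ<n; remQuot-combine; combine-remQuot
        ; ¬∀⟶∃¬; injective⇒≤)
  renaming (_≟_ to _≟ᶠ_)
open import Data.Bool using (Bool; true; false; T; not; _∨_)
open import Data.Bool.Properties using (T-≡; T-∧) renaming (_≟_ to _≟ᵇ_)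
open import Data.List
  using (List; []; _∷_; _++_; map; filter; length; allFin; concatMap; cartesianProductWith)
open import Data.List.Properties using (length-map)
open import Data.List.Membership.Propositional using (_∈_)
open import Data.List.Membership.Propositional.Properties
  using (∈-allFin; ∈-filter⁺; ∈-filter⁻; ∈-map⁺; ∈-map⁻; ∈-length; ∈-cartesianProductWith⁺)
open import Data.List.Membership.Propositional.Properties.WithK using (unique∧set⇒bag)
open import Data.List.Relation.Binary.BagAndSetEquality using (∼bag⇒↭)
open import Data.List.Relation.Binary.Permutation.Propositional.Properties using (↭-length)
open import Data.List.Relation.Unary.Any using (here)
open import Data.List.Relation.Unary.All as All using (All; []; _∷_)
open import Data.List.Relation.Unary.AllPairs using ([]; _∷_)
open import Data.List.Relation.Unary.Unique.Propositional using (Unique)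
import Data.List.Relation.Unary.Unique.Propositional.Properties as Unique
import Data.Vec as Vec
open import Data.Vec using (Vec; lookup; tabulate)
open import Data.Vec.Properties using (lookup-map; lookup-zipWith; lookup∘tabulate)
open import Data.Product using (Σ; _×_; _,_; proj₁; proj₂)
open import Data.Sum using (_⊎_; inj₁; inj₂)
open import Data.Unit using (tt)
open import Data.Empty using (⊥-elim)
open import Function using (_∘_; _⇔_; mk⇔; Equivalence)
open import Relation.Binary using (tri<; tri≈; tri>)
open import Relation.Binary.PropositionalEquality
open import Relation.Nullary using (¬_)
open import Relation.Nullary.Decidable using (⌊_⌋; toWitness; fromWitness)

-- Counting homomorphisms

Preserves : (F D : Digraph) → (Fin (size F) → Fin (size D)) → Set
Preserves F D π = ∀ i j → T (edge F i j) → T (edge D (π i) (π j))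

infix 4 _⟶_

_⟶_ : Digraph → Digraph → Set
F ⟶ D = Σ (Fin (size F) → Fin (size D)) (Preserves F D)

Preserves-cong : ∀ {F D π π′} → (∀ i → π i ≡ π′ i) → Preserves F D π → Preserves F D π′
Preserves-cong {D = D} eq pres i j e = subst₂ (λ x y → T (edge D x y)) (eq i) (eq j) (pres i j e)

⟶-trans : ∀ {F D E} → F ⟶ D → D ⟶ E → F ⟶ E
⟶-trans (π , pres) (ρ , pres′) = ρ ∘ π , λ i j → pres′ (π i) (π j) ∘ pres i j

Maps : Digraph → Digraph → Set
Maps F D = Vec (Fin (size D)) (size F)

homs : (F D : Digraph) → List (Maps F D)
homs F D = filter (λ f → isHom F D f ≟ᵇ true) (allMaps (size F) (size D))

allMaps-suc : ∀ a b →
  allMaps (suc a) b ≡ cartesianProductWith (λ f i → i Vec.∷ f) (allMaps a b) (allFin b)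
allMaps-suc a b = go (allMaps a b)
  where
  go : ∀ fs → concatMap (λ f → map (Vec._∷ f) (allFin b)) fs
            ≡ cartesianProductWith (λ f i → i Vec.∷ f) fs (allFin b)
  go []       = refl
  go (f ∷ fs) = cong (map (Vec._∷ f) (allFin b) ++_) (go fs)

∈-allMaps : ∀ {a b} (f : Vec (Fin b) a) → f ∈ allMaps a b
∈-allMaps {zero}      Vec.[]      = here refl
∈-allMaps {suc a} {b} (i Vec.∷ f) = subst ((i Vec.∷ f) ∈_) (sym (allMaps-suc a b))
  (∈-cartesianProductWith⁺ (λ f i → i Vec.∷ f) (∈-allMaps f) (∈-allFin i))

allMaps-unique : ∀ a b → Unique (allMaps a b)
allMaps-unique zero    b = [] ∷ []
allMaps-unique (suc a) b = subst Unique (sym (allMaps-suc a b))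
  (Unique.cartesianProductWith⁺ (λ f i → i Vec.∷ f) ∷-injective
    (allMaps-unique a b) (Unique.allFin⁺ b))
  where
  ∷-injective : ∀ {f g i j} → i Vec.∷ f ≡ j Vec.∷ g → f ≡ g × i ≡ j
  ∷-injective refl = refl , refl

T-all : ∀ {A : Set} (p : A → Bool) xs → T (all p xs) ⇔ All (T ∘ p) xs
T-all p []       = mk⇔ (λ _ → []) (λ _ → tt)
T-all p (x ∷ xs) = mk⇔
  (λ t → let (px , pxs) = Equivalence.to T-∧ t in px ∷ Equivalence.to (T-all p xs) pxs)
  (λ { (px ∷ pxs) → Equivalence.from T-∧ (px , Equivalence.from (T-all p xs) pxs) })

T-not-∨ : ∀ {b c} → T (not b ∨ c) ⇔ (T b → T c)
T-not-∨ {true}  = mk⇔ (λ t _ → t) (λ h → h tt)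
T-not-∨ {false} = mk⇔ (λ _ ()) (λ _ → tt)

isHom⇔Preserves : ∀ F D (f : Maps F D) → isHom F D f ≡ true ⇔ Preserves F D (lookup f)
isHom⇔Preserves F D f = mk⇔
  (λ h i j → Equivalence.to T-not-∨
    (All.lookup (rowOK i (All.lookup (allRows h) (∈-allFin i))) (∈-allFin j)))
  (λ pres → Equivalence.to T-≡ (Equivalence.from (T-all row vertices) (All.tabulate λ {i} _ →
    Equivalence.from (T-all (entry i) vertices) (All.tabulate λ {j} _ →
      Equivalence.from T-not-∨ (pres i j)))))
  where
  vertices = allFin (size F)
  entry : Fin (size F) → Fin (size F) → Bool
  entry i j = not (edge F i j) ∨ edge D (lookup f i) (lookup f j)
  row : Fin (size F) → Bool
  row i = all (entry i) vertices
  allRows : isHom F D f ≡ true → All (T ∘ row) vertices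
  allRows = Equivalence.to (T-all row vertices) ∘ Equivalence.from T-≡
  rowOK : ∀ i → T (row i) → All (T ∘ entry i) vertices
  rowOK i = Equivalence.to (T-all (entry i) vertices)

∈-homs⇔ : ∀ F D (f : Maps F D) → f ∈ homs F D ⇔ Preserves F D (lookup f)
∈-homs⇔ F D f = mk⇔
  (Equivalence.to (isHom⇔Preserves F D f) ∘ proj₂ ∘ ∈-filter⁻ isHom? {xs = allMaps (size F) (size D)})
  (∈-filter⁺ isHom? (∈-allMaps f) ∘ Equivalence.from (isHom⇔Preserves F D f))
  where isHom? = λ g → isHom F D g ≟ᵇ true

homs-unique : ∀ F D → Unique (homs F D)
homs-unique F D = Unique.filter⁺ (λ g → isHom F D g ≟ᵇ true) (allMaps-unique (size F) (size D))

hom>0⇒∃ : ∀ {F D} → 0 < hom F D → Σ (Maps F D) (Preserves F D ∘ lookup)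
hom>0⇒∃ {F} {D} hom>0 with homs F D in eq
... | f ∷ _ = f , Equivalence.to (∈-homs⇔ F D f) (subst (f ∈_) (sym eq) (here refl))

⟶⇒hom>0 : ∀ {F D} → F ⟶ D → 0 < hom F D
⟶⇒hom>0 {F} {D} (π , pres) = ∈-length (Equivalence.from (∈-homs⇔ F D (tabulate π))
  (Preserves-cong {F} {D} (λ i → sym (lookup∘tabulate π i)) pres))

hom>0⇒⟶ : ∀ {F D} → 0 < hom F D → F ⟶ D
hom>0⇒⟶ {F} {D} hom>0 = let (f , pres) = hom>0⇒∃ {F} {D} hom>0 in lookup f , pres

hom>0-transport : ∀ {F D E} → D ⟶ E → 0 < hom F D → 0 < hom F E
hom>0-transport {F} {D} {E} D⟶E hom>0 =
  ⟶⇒hom>0 {F} {E} (⟶-trans {F} {D} {E} (hom>0⇒⟶ {F} {D} hom>0) D⟶E)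

zipWith-inverse : ∀ {A B : Set} {n} {g h : A → B → A} → (∀ x y → g (h x y) y ≡ x) →
  (xs : Vec A n) (ys : Vec B n) → Vec.zipWith g (Vec.zipWith h xs ys) ys ≡ xs
zipWith-inverse inv Vec.[]       Vec.[]       = refl
zipWith-inverse inv (x Vec.∷ xs) (y Vec.∷ ys) = cong₂ Vec._∷_ (inv x y) (zipWith-inverse inv xs ys)

bijection⇒hom≡ : ∀ {F D E} (σ : Maps F D → Maps F E) (τ : Maps F E → Maps F D) →
  (∀ f → τ (σ f) ≡ f) → (∀ g → σ (τ g) ≡ g) →
  (∀ f → Preserves F D (lookup f) → Preserves F E (lookup (σ f))) →
  (∀ g → Preserves F E (lookup g) → Preserves F D (lookup (τ g))) →
  hom F D ≡ hom F E
bijection⇒hom≡ {F} {D} {E} σ τ τσ στ σ-pres τ-pres = begin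
  hom F D                    ≡⟨ length-map σ (homs F D) ⟨
  length (map σ (homs F D))  ≡⟨ ↭-length (∼bag⇒↭ (unique∧set⇒bag σ-homs-unique (homs-unique F E) same)) ⟩
  hom F E                    ∎
  where
  open ≡-Reasoning
  σ-homs-unique : Unique (map σ (homs F D))
  σ-homs-unique = Unique.map⁺ (λ {f} {f′} eq → trans (sym (τσ f)) (trans (cong τ eq) (τσ f′)))
    (homs-unique F D)
  same : ∀ {g} → g ∈ map σ (homs F D) ⇔ g ∈ homs F E
  same {g} = mk⇔
    (λ g∈ → let (f , f∈ , g≡σf) = ∈-map⁻ σ g∈ in subst (_∈ homs F E) (sym g≡σf)
      (Equivalence.from (∈-homs⇔ F E (σ f)) (σ-pres f (Equivalence.to (∈-homs⇔ F D f) f∈))))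
    (λ g∈ → subst (_∈ map σ (homs F D)) (στ g) (∈-map⁺ σ
      (Equivalence.from (∈-homs⇔ F D (τ g)) (τ-pres g (Equivalence.to (∈-homs⇔ F E g) g∈)))))

[m%d+n]%d≡[m+n]%d : ∀ m n d .{{_ : NonZero d}} → (m % d + n) % d ≡ (m + n) % d
[m%d+n]%d≡[m+n]%d m n d = begin
  (m % d + n) % d            ≡⟨ %-distribˡ-+ (m % d) n d ⟩
  (m % d % d + n % d) % d    ≡⟨ cong (λ x → (x + n % d) % d) (m%n%n≡m%n m d) ⟩
  (m % d + n % d) % d        ≡⟨ %-distribˡ-+ m n d ⟨
  (m + n) % d                ∎
  where open ≡-Reasoning

[m+n%d]%d≡[m+n]%d : ∀ m n d .{{_ : NonZero d}} → (m + n % d) % d ≡ (m + n) % d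
[m+n%d]%d≡[m+n]%d m n d = begin
  (m + n % d) % d  ≡⟨ cong (_% d) (+-comm m (n % d)) ⟩
  (n % d + m) % d  ≡⟨ [m%d+n]%d≡[m+n]%d n m d ⟩
  (n + m) % d      ≡⟨ cong (_% d) (+-comm n m) ⟩
  (m + n) % d      ∎
  where open ≡-Reasoning

module Modular (p : ℕ) .{{_ : NonZero p}} where

  next : Fin p → Fin p
  next x = suc (toℕ x) mod p

  infixl 6 _⊕_ _⊖_

  _⊕_ : Fin p → Fin p → Fin p
  x ⊕ y = (toℕ x + toℕ y) mod p

  _⊖_ : Fin p → Fin p → Fin p
  x ⊖ y = (toℕ x + (p ∸ toℕ y)) mod p

  toℕ-mod : ∀ m → toℕ (m mod p) ≡ m % p
  toℕ-mod m = toℕ-fromℕ< (m%n<n m p)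

  mod-toℕ : ∀ {m} (x : Fin p) → m % p ≡ toℕ x → m mod p ≡ x
  mod-toℕ {m} x eq = toℕ-injective (trans (toℕ-mod m) eq)

  mod-cong : ∀ {m n} → m % p ≡ n % p → m mod p ≡ n mod p
  mod-cong {m} {n} eq = toℕ-injective (trans (toℕ-mod m) (trans eq (sym (toℕ-mod n))))

  [[x+a]%p+b]%p≡x : ∀ (x : Fin p) {a b} → a + b ≡ p → ((toℕ x + a) % p + b) % p ≡ toℕ x
  [[x+a]%p+b]%p≡x x {a} {b} a+b≡p = begin
    ((toℕ x + a) % p + b) % p  ≡⟨ [m%d+n]%d≡[m+n]%d (toℕ x + a) b p ⟩
    (toℕ x + a + b) % p        ≡⟨ cong (_% p) (+-assoc (toℕ x) a b) ⟩
    (toℕ x + (a + b)) % p      ≡⟨ cong (λ z → (toℕ x + z) % p) a+b≡p ⟩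
    (toℕ x + p) % p            ≡⟨ [m+n]%n≡m%n (toℕ x) p ⟩
    toℕ x % p                  ≡⟨ m<n⇒m%n≡m (toℕ<n x) ⟩
    toℕ x                      ∎
    where open ≡-Reasoning

  next-mod : ∀ m → next (m mod p) ≡ suc m mod p
  next-mod m = mod-cong (begin
    suc (toℕ (m mod p)) % p  ≡⟨ cong (λ x → suc x % p) (toℕ-mod m) ⟩
    (1 + m % p) % p          ≡⟨ [m+n%d]%d≡[m+n]%d 1 m p ⟩
    suc m % p                ∎)
    where open ≡-Reasoning

  ⊕-comm : ∀ x y → x ⊕ y ≡ y ⊕ x
  ⊕-comm x y = cong (_mod p) (+-comm (toℕ x) (toℕ y))

  ⊕-next : ∀ x y → x ⊕ next y ≡ next (x ⊕ y)
  ⊕-next x y = begin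
    (toℕ x + toℕ (suc (toℕ y) mod p)) mod p ≡⟨ cong (λ z → (toℕ x + z) mod p) (toℕ-mod (suc (toℕ y))) ⟩
    (toℕ x + suc (toℕ y) % p) mod p         ≡⟨ mod-cong ([m+n%d]%d≡[m+n]%d (toℕ x) (suc (toℕ y)) p) ⟩
    (toℕ x + suc (toℕ y)) mod p             ≡⟨ cong (_mod p) (+-suc (toℕ x) (toℕ y)) ⟩
    suc (toℕ x + toℕ y) mod p               ≡⟨ next-mod (toℕ x + toℕ y) ⟨
    next (x ⊕ y)                            ∎
    where open ≡-Reasoning

  ⊖-⊕ : ∀ x y → x ⊖ y ⊕ y ≡ x
  ⊖-⊕ x y = mod-toℕ x (trans (cong (λ z → (z + toℕ y) % p) (toℕ-mod _))
    ([[x+a]%p+b]%p≡x x (m∸n+n≡m (<⇒≤ (toℕ<n y)))))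

  ⊕-⊖ : ∀ x y → x ⊕ y ⊖ y ≡ x
  ⊕-⊖ x y = mod-toℕ x (trans (cong (λ z → (z + (p ∸ toℕ y)) % p) (toℕ-mod _))
    ([[x+a]%p+b]%p≡x x (m+[n∸m]≡n (<⇒≤ (toℕ<n y)))))

  ⊕-cancelʳ : ∀ {x y} z → x ⊕ z ≡ y ⊕ z → x ≡ y
  ⊕-cancelʳ {x} {y} z eq = trans (sym (⊕-⊖ x z)) (trans (cong (_⊖ z) eq) (⊕-⊖ y z))

  ⊖-cancelˡ : ∀ x {y z} → x ⊖ y ≡ x ⊖ z → y ≡ z
  ⊖-cancelˡ x {y} {z} eq = ⊕-cancelʳ (x ⊖ y) (begin
    y ⊕ (x ⊖ y)  ≡⟨ ⊕-comm y (x ⊖ y) ⟩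
    x ⊖ y ⊕ y    ≡⟨ ⊖-⊕ x y ⟩
    x            ≡⟨ ⊖-⊕ x z ⟨
    x ⊖ z ⊕ z    ≡⟨ cong (_⊕ z) eq ⟨
    x ⊖ y ⊕ z    ≡⟨ ⊕-comm (x ⊖ y) z ⟩
    z ⊕ (x ⊖ y)  ∎)
    where open ≡-Reasoning

  next-⊖-next : ∀ x y → next x ⊖ next y ≡ x ⊖ y
  next-⊖-next x y = begin
    next x ⊖ next y              ≡⟨ cong (λ z → next z ⊖ next y) (⊖-⊕ x y) ⟨
    next (x ⊖ y ⊕ y) ⊖ next y    ≡⟨ cong (_⊖ next y) (⊕-next (x ⊖ y) y) ⟨
    x ⊖ y ⊕ next y ⊖ next y      ≡⟨ ⊕-⊖ (x ⊖ y) (next y) ⟩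
    x ⊖ y                        ∎
    where open ≡-Reasoning

-- Disjoint unions of directed cycles

module Union {r : ℕ} (H : Digraph) where

  copy : Fin (r * size H) → Fin r
  copy u = proj₁ (remQuot {r} (size H) u)

  pos : Fin (r * size H) → Fin (size H)
  pos u = proj₂ (remQuot {r} (size H) u)

  copy-combine : ∀ c x → copy (combine c x) ≡ c
  copy-combine c x = cong proj₁ (remQuot-combine {r} {size H} c x)

  pos-combine : ∀ c x → pos (combine c x) ≡ x
  pos-combine c x = cong proj₂ (remQuot-combine {r} {size H} c x)

  combine-copy-pos : ∀ u → combine (copy u) (pos u) ≡ u
  combine-copy-pos u = combine-remQuot {r} (size H) u

  ·-edge⇔ : ∀ (c : Fin r) u w → T (edge (c · H) u w) ⇔ (copy u ≡ copy w × T (edge H (pos u) (pos w)))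
  ·-edge⇔ c u w = mk⇔
    (λ e → let (same , e′) = Equivalence.to T-∧ e in toWitness same , e′)
    (λ (same , e′) → Equivalence.from T-∧ (fromWitness same , e′))

  ·-projection : (c : Fin r) → c · H ⟶ H
  ·-projection c = pos , λ u w → proj₂ ∘ Equivalence.to (·-edge⇔ c u w)

  ·-embedding : (c : Fin r) → H ⟶ c · H
  ·-embedding c = combine c , λ x y e → Equivalence.from (·-edge⇔ c _ _)
    (trans (copy-combine c x) (sym (copy-combine c y)) ,
     subst₂ (λ x′ y′ → T (edge H x′ y′)) (sym (pos-combine c x)) (sym (pos-combine c y)) e)

module Cycle {p : ℕ} .{{_ : NonZero p}} where
  open Modular p

  cycle-edge⇔ : ∀ (v : Fin p) x y → T (edge (cycle p v) x y) ⇔ y ≡ next x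
  cycle-edge⇔ v x y = mk⇔
    (λ e → toℕ-injective (trans (toWitness e) (sym (toℕ-mod (suc (toℕ x))))))
    (λ y≡next → fromWitness (trans (cong toℕ y≡next) (toℕ-mod (suc (toℕ x)))))

  cycle-edge : ∀ (v : Fin p) x → T (edge (cycle p v) x (next x))
  cycle-edge v x = Equivalence.from (cycle-edge⇔ v x (next x)) refl

module _ {p q : ℕ} .{{_ : NonZero p}} .{{_ : NonZero q}} {v : Fin q} {w : Fin p} where
  open Cycle
  open Modular p
  open Modular q using ()
    renaming (next to nextq; next-mod to nextq-mod; mod-cong to modq-cong; toℕ-mod to toℕ-modq)

  cycle-fold : p ∣ q → cycle q v ⟶ cycle p w
  cycle-fold p∣q = (λ x → toℕ x mod p) , λ x y e → Equivalence.from (cycle-edge⇔ w _ _) (begin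
    toℕ y mod p               ≡⟨ cong (λ z → toℕ z mod p) (Equivalence.to (cycle-edge⇔ v x y) e) ⟩
    toℕ (nextq x) mod p       ≡⟨ mod-cong (trans (cong (_% p) (toℕ-modq (suc (toℕ x))))
                                                  (m∣n⇒o%n%m≡o%m p q (suc (toℕ x)) p∣q)) ⟩
    suc (toℕ x) mod p         ≡⟨ next-mod (toℕ x) ⟨
    next (toℕ x mod p)        ∎)
    where open ≡-Reasoning

  -- The offset π t ⊖ t is constant along the cycle; going once around gives q ≡ 0 (mod p).
  cycle⟶cycle⇒∣ : cycle q v ⟶ cycle p w → p ∣ q
  cycle⟶cycle⇒∣ (π , pres) = m%n≡0⇒n∣m q p (begin
    q % p              ≡⟨ toℕ-mod q ⟨
    toℕ (q mod p)      ≡⟨ cong toℕ q≡0-mod-p ⟩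
    toℕ (0 mod p)      ≡⟨ toℕ-mod 0 ⟩
    0 % p              ≡⟨ m<n⇒m%n≡m (>-nonZero⁻¹ p) ⟩
    0                  ∎)
    where
    open ≡-Reasoning
    commutes : ∀ x → π (nextq x) ≡ next (π x)
    commutes x = Equivalence.to (cycle-edge⇔ w _ _) (pres x (nextq x) (cycle-edge v x))
    offset-constant : ∀ t → π (t mod q) ⊖ (t mod p) ≡ π (0 mod q) ⊖ (0 mod p)
    offset-constant zero    = refl
    offset-constant (suc t) = begin
      π (suc t mod q) ⊖ (suc t mod p)           ≡⟨ cong₂ (λ a b → π a ⊖ b) (nextq-mod t) (next-mod t) ⟨
      π (nextq (t mod q)) ⊖ next (t mod p)      ≡⟨ cong (_⊖ next (t mod p)) (commutes (t mod q)) ⟩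
      next (π (t mod q)) ⊖ next (t mod p)       ≡⟨ next-⊖-next (π (t mod q)) (t mod p) ⟩
      π (t mod q) ⊖ (t mod p)                   ≡⟨ offset-constant t ⟩
      π (0 mod q) ⊖ (0 mod p)                   ∎
    q≡0-mod-q : q mod q ≡ 0 mod q
    q≡0-mod-q = modq-cong ([m+n]%n≡m%n 0 q)
    q≡0-mod-p : q mod p ≡ 0 mod p
    q≡0-mod-p = ⊖-cancelˡ (π (0 mod q)) (begin
      π (0 mod q) ⊖ (q mod p)   ≡⟨ cong (λ a → π a ⊖ (q mod p)) q≡0-mod-q ⟨
      π (q mod q) ⊖ (q mod p)   ≡⟨ offset-constant q ⟩
      π (0 mod q) ⊖ (0 mod p)   ∎)

loops : (S : ℕ) → Fin S → Digraph
loops S w = record { size = S ; edge = λ x y → ⌊ x ≟ᶠ y ⌋ ; aVertex = w }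

hom-loops-size : ∀ F {S S′} (w : Fin S) (w′ : Fin S′) → S ≡ S′ →
  hom F (loops S w) ≡ hom F (loops S′ w′)
hom-loops-size F w w′ refl = refl

module _ {s p : ℕ} .{{_ : NonZero p}} (c : Fin s) (v : Fin p) where
  open Modular p
  open Cycle
  open Union {s} (cycle p v)

  private
    D : Digraph
    D = c · cycle p v

  edge-·-cycle⇔ : ∀ u w → T (edge D u w) ⇔ (copy u ≡ copy w × pos w ≡ next (pos u))
  edge-·-cycle⇔ u w = mk⇔
    (λ e → let (same , e′) = Equivalence.to (·-edge⇔ c u w) e in
      same , Equivalence.to (cycle-edge⇔ v _ _) e′)
    (λ (same , w≡next) →
      Equivalence.from (·-edge⇔ c u w) (same , Equivalence.from (cycle-edge⇔ v _ _) w≡next))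

  infixl 6 _⊕ᵛ_ _⊖ᵛ_

  _⊕ᵛ_ : Fin (s * p) → Fin (s * p) → Fin (s * p)
  u ⊕ᵛ g = combine (copy u) (pos u ⊕ pos g)

  _⊖ᵛ_ : Fin (s * p) → Fin (s * p) → Fin (s * p)
  u ⊖ᵛ g = combine (copy u) (pos u ⊖ pos g)

  ⊖ᵛ-⊕ᵛ : ∀ u g → u ⊖ᵛ g ⊕ᵛ g ≡ u
  ⊖ᵛ-⊕ᵛ u g = begin
    combine (copy (u ⊖ᵛ g)) (pos (u ⊖ᵛ g) ⊕ pos g)
      ≡⟨ cong₂ (λ a x → combine a (x ⊕ pos g)) (copy-combine _ _) (pos-combine _ _) ⟩
    combine (copy u) (pos u ⊖ pos g ⊕ pos g)      ≡⟨ cong (combine (copy u)) (⊖-⊕ (pos u) (pos g)) ⟩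
    combine (copy u) (pos u)                      ≡⟨ combine-copy-pos u ⟩
    u                                             ∎
    where open ≡-Reasoning

  ⊕ᵛ-⊖ᵛ : ∀ u g → u ⊕ᵛ g ⊖ᵛ g ≡ u
  ⊕ᵛ-⊖ᵛ u g = begin
    combine (copy (u ⊕ᵛ g)) (pos (u ⊕ᵛ g) ⊖ pos g)
      ≡⟨ cong₂ (λ a x → combine a (x ⊖ pos g)) (copy-combine _ _) (pos-combine _ _) ⟩
    combine (copy u) (pos u ⊕ pos g ⊖ pos g)      ≡⟨ cong (combine (copy u)) (⊕-⊖ (pos u) (pos g)) ⟩
    combine (copy u) (pos u)                      ≡⟨ combine-copy-pos u ⟩
    u                                             ∎
    where open ≡-Reasoning

  ⊖ᵛ-edge : ∀ {g h u w} → T (edge D g h) → T (edge D u w) → u ⊖ᵛ g ≡ w ⊖ᵛ h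
  ⊖ᵛ-edge {g} {h} {u} {w} g→h u→w = cong₂ combine same-copy (begin
    pos u ⊖ pos g                ≡⟨ next-⊖-next (pos u) (pos g) ⟨
    next (pos u) ⊖ next (pos g)  ≡⟨ cong₂ _⊖_ (sym w≡next) (sym h≡next) ⟩
    pos w ⊖ pos h                ∎)
    where
    open ≡-Reasoning
    same-copy = proj₁ (Equivalence.to (edge-·-cycle⇔ u w) u→w)
    w≡next = proj₂ (Equivalence.to (edge-·-cycle⇔ u w) u→w)
    h≡next = proj₂ (Equivalence.to (edge-·-cycle⇔ g h) g→h)

  ⊕ᵛ-edge : ∀ {g h} x → T (edge D g h) → T (edge D (x ⊕ᵛ g) (x ⊕ᵛ h))
  ⊕ᵛ-edge {g} {h} x g→h = Equivalence.from (edge-·-cycle⇔ _ _)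
    (trans (copy-combine _ _) (sym (copy-combine _ _)) , (begin
      pos (x ⊕ᵛ h)              ≡⟨ pos-combine _ _ ⟩
      pos x ⊕ pos h             ≡⟨ cong (pos x ⊕_) (proj₂ (Equivalence.to (edge-·-cycle⇔ g h) g→h)) ⟩
      pos x ⊕ next (pos g)      ≡⟨ ⊕-next (pos x) (pos g) ⟩
      next (pos x ⊕ pos g)      ≡⟨ cong next (pos-combine _ _) ⟨
      next (pos (x ⊕ᵛ g))       ∎))
    where open ≡-Reasoning

  hom>0⇒hom≡loops : ∀ F (w : Fin (s * p)) → 0 < hom F D → hom F D ≡ hom F (loops (s * p) w)
  hom>0⇒hom≡loops F w hom>0 = bijection⇒hom≡ {F} {D} {L} σ τ
    (λ f → zipWith-inverse ⊖ᵛ-⊕ᵛ f f₀) (λ g → zipWith-inverse ⊕ᵛ-⊖ᵛ g f₀) σ-pres τ-pres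
    where
    L = loops (s * p) w
    f₀ = proj₁ (hom>0⇒∃ {F} {D} hom>0)
    f₀-pres = proj₂ (hom>0⇒∃ {F} {D} hom>0)
    σ τ : Maps F D → Maps F L
    σ f = Vec.zipWith _⊖ᵛ_ f f₀
    τ g = Vec.zipWith _⊕ᵛ_ g f₀
    σ-pres : ∀ f → Preserves F D (lookup f) → Preserves F L (lookup (σ f))
    σ-pres f pres = Preserves-cong {F} {L} (λ i → sym (lookup-zipWith _⊖ᵛ_ i f f₀))
      λ i j e → fromWitness (⊖ᵛ-edge (f₀-pres i j e) (pres i j e))
    τ-pres : ∀ g → Preserves F L (lookup g) → Preserves F D (lookup (τ g))
    τ-pres g pres = Preserves-cong {F} {D} (λ i → sym (lookup-zipWith _⊕ᵛ_ i g f₀))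
      λ i j e → subst (λ y → T (edge D (lookup g i ⊕ᵛ lookup f₀ i) (y ⊕ᵛ lookup f₀ j)))
        (toWitness (pres i j e)) (⊕ᵛ-edge (lookup g i) (f₀-pres i j e))

2^-nonZero : ∀ m → NonZero (2 ^ m)
2^-nonZero m = m^n≢0 2 m

2^[b∸a]*2^a≡2^b : ∀ {a b} → a ≤ b → 2 ^ (b ∸ a) * 2 ^ a ≡ 2 ^ b
2^[b∸a]*2^a≡2^b {a} {b} a≤b = begin
  2 ^ (b ∸ a) * 2 ^ a  ≡⟨ ^-distribˡ-+-* 2 (b ∸ a) a ⟨
  2 ^ (b ∸ a + a)      ≡⟨ cong (2 ^_) (m∸n+n≡m a≤b) ⟩
  2 ^ b                ∎
  where open ≡-Reasoning

2^-∣ : ∀ {a b} → a ≤ b → 2 ^ a ∣ 2 ^ b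
2^-∣ {a} {b} a≤b = divides (2 ^ (b ∸ a)) (sym (2^[b∸a]*2^a≡2^b a≤b))

C[_] : ℕ → Digraph
C[ m ] = cycle (2 ^ m) (zero2^ m)

module _ {n : ℕ} where

  D-hom>0⇒hom≡loops : ∀ F {m} → m ≤ n → 0 < hom F D[ n , m ] →
    hom F D[ n , m ] ≡ hom F (loops (2 ^ n) (zero2^ n))
  D-hom>0⇒hom≡loops F {m} m≤n hom>0 = trans
    (hom>0⇒hom≡loops {{2^-nonZero m}} (zero2^ (n ∸ m)) (zero2^ m) F (aVertex D[ n , m ]) hom>0)
    (hom-loops-size F (aVertex D[ n , m ]) (zero2^ n) (2^[b∸a]*2^a≡2^b m≤n))

  D-hom>0-constant : ∀ F {a b} → a ≤ n → b ≤ n → 0 < hom F D[ n , a ] → 0 < hom F D[ n , b ] →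
    hom F D[ n , a ] ≡ hom F D[ n , b ]
  D-hom>0-constant F a≤n b≤n ha hb =
    trans (D-hom>0⇒hom≡loops F a≤n ha) (sym (D-hom>0⇒hom≡loops F b≤n hb))

  D-fold : ∀ {a b} → a ≤ b → D[ n , b ] ⟶ D[ n , a ]
  D-fold {a} {b} a≤b =
    ⟶-trans {D[ n , b ]} {C[ b ]} {D[ n , a ]} (Union.·-projection C[ b ] (zero2^ (n ∸ b)))
      (⟶-trans {C[ b ]} {C[ a ]} {D[ n , a ]}
        (cycle-fold {{2^-nonZero a}} {{2^-nonZero b}} {zero2^ b} {zero2^ a} (2^-∣ a≤b))
        (Union.·-embedding C[ a ] (zero2^ (n ∸ a))))

  D-hom>0-antitone : ∀ F {a b} → a ≤ b → 0 < hom F D[ n , b ] → 0 < hom F D[ n , a ]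
  D-hom>0-antitone F {a} {b} a≤b = hom>0-transport {F} {D[ n , b ]} {D[ n , a ]} (D-fold a≤b)

  C-hom>0 : ∀ m → 0 < hom C[ m ] D[ n , m ]
  C-hom>0 m = ⟶⇒hom>0 {C[ m ]} {D[ n , m ]} (Union.·-embedding C[ m ] (zero2^ (n ∸ m)))

  C-hom≯0 : ∀ {a b} → a < b → ¬ 0 < hom C[ a ] D[ n , b ]
  C-hom≯0 {a} {b} a<b hom>0 = >⇒∤ {{2^-nonZero a}} (^-monoʳ-< 2 (s≤s (s≤s z≤n)) a<b)
    (cycle⟶cycle⇒∣ {{2^-nonZero b}} {{2^-nonZero a}} {zero2^ a} {zero2^ b}
      (⟶-trans {C[ a ]} {D[ n , b ]} {C[ b ]} (hom>0⇒⟶ {C[ a ]} {D[ n , b ]} hom>0)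
        (Union.·-projection C[ b ] (zero2^ (n ∸ b)))))

profile : ∀ {k} → Vec Digraph k → Digraph → Vec ℕ k
profile qs D = Vec.map (λ F → hom F D) qs

profile-≡ : ∀ {k} (qs : Vec Digraph k) D D′ →
  (∀ i → hom (lookup qs i) D ≡ hom (lookup qs i) D′) → profile qs D ≡ profile qs D′
profile-≡ Vec.[]       D D′ _    = refl
profile-≡ (F Vec.∷ qs) D D′ same =
  cong₂ Vec._∷_ (same Fin.zero) (profile-≡ qs D D′ (same ∘ Fin.suc))

Distinguishes : ∀ {k} → Vec Digraph k → (Digraph → Set) → (Digraph → Set) → Set
Distinguishes qs 𝒜 ℬ = ∀ {D D′} → 𝒜 D → ℬ D′ → profile qs D ≢ profile qs D′

separates⇒distinguishes : ∀ {k} {A : Algorithm k} {𝒜 ℬ} →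
  Separates A 𝒜 ℬ → Distinguishes (queries A) 𝒜 ℬ
separates⇒distinguishes {A = A} (inj₁ (acc , rej)) {D} {D′} 𝒜D ℬD′ eq =
  rej D′ ℬD′ (subst (accSet A) eq (acc D 𝒜D))
separates⇒distinguishes {A = A} (inj₂ (rej , acc)) {D} {D′} 𝒜D ℬD′ eq =
  rej D 𝒜D (subst (accSet A) (sym eq) (acc D′ ℬD′))

distinguishes⇒separates : ∀ {k} (qs : Vec Digraph k) {𝒜 ℬ} → Distinguishes qs 𝒜 ℬ →
  Σ (Algorithm k) λ A → Separates A 𝒜 ℬ
distinguishes⇒separates qs {𝒜} dist =
  A , inj₁ ((λ D 𝒜D → D , 𝒜D , refl) , λ D′ ℬD′ (D , 𝒜D , eq) → dist 𝒜D ℬD′ eq)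
  where
  A : Algorithm _
  A = record { queries = qs ; accSet = λ v → Σ Digraph λ D → 𝒜 D × profile qs D ≡ v }

-- Lower bound

even⇒suc-odd : ∀ {m} → 2 ∣ m → 2 ∤ suc m
even⇒suc-odd {m} 2∣m 2∣1+m
  with () ← ∣1⇒≡1 (∣m+n∣m⇒∣n (subst (2 ∣_) (+-comm 1 m) 2∣1+m) 2∣m)

even⊎suc-even : ∀ m → 2 ∣ m ⊎ 2 ∣ suc m
even⊎suc-even zero    = inj₁ (divides 0 refl)
even⊎suc-even (suc m) with even⊎suc-even m
... | inj₁ 2∣m   = inj₂ (∣m∣n⇒∣m+n (divides 1 refl) 2∣m)
... | inj₂ 2∣1+m = inj₁ 2∣1+m

D-consecutive : ∀ {n m} → m < n →
  (𝒟 n D[ n , m ] × 𝒟′ n D[ n , suc m ]) ⊎ (𝒟′ n D[ n , m ] × 𝒟 n D[ n , suc m ])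
D-consecutive {n} {m} m<n with even⊎suc-even m
... | inj₁ 2∣m   = inj₁ ((m , <⇒≤ m<n , 2∣m , refl) , (suc m , m<n , even⇒suc-odd 2∣m , refl))
... | inj₂ 2∣1+m = inj₂ ( (m , <⇒≤ m<n , (λ 2∣m → even⇒suc-odd 2∣m 2∣1+m) , refl)
                        , (suc m , m<n , 2∣1+m , refl))

ChangesAt : ℕ → Digraph → ℕ → Set
ChangesAt n F m = hom F D[ n , m ] ≢ hom F D[ n , suc m ]

module _ {n : ℕ} (F : Digraph) where

  changes⇒vanishes-after : ∀ {m} → m < n → ChangesAt n F m →
    ∀ {b} → m < b → b ≤ n → hom F D[ n , b ] ≡ 0
  changes⇒vanishes-after m<n changes m<b b≤n = n≤0⇒n≡0 (≮⇒≥ λ hom>0 →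
    changes (D-hom>0-constant F (<⇒≤ m<n) m<n
      (D-hom>0-antitone F (<⇒≤ m<b) hom>0) (D-hom>0-antitone F m<b hom>0)))

  no-later-change : ∀ {m m′} → m < m′ → m′ < n → ChangesAt n F m → ¬ ChangesAt n F m′
  no-later-change {m} {m′} m<m′ m′<n changes changes′ = changes′ (begin
    hom F D[ n , m′ ]      ≡⟨ vanishes m<m′ (<⇒≤ m′<n) ⟩
    0                      ≡⟨ vanishes (≤-trans m<m′ (n≤1+n m′)) m′<n ⟨
    hom F D[ n , suc m′ ]  ∎)
    where
    open ≡-Reasoning
    vanishes = changes⇒vanishes-after (<-trans m<m′ m′<n) changes

  changes-unique : ∀ {m m′} → m < n → m′ < n → ChangesAt n F m → ChangesAt n F m′ → m ≡ m′
  changes-unique {m} {m′} m<n m′<n changes changes′ with <-cmp m m′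
  ... | tri< m<m′ _ _ = ⊥-elim (no-later-change m<m′ m′<n changes changes′)
  ... | tri≈ _ m≡m′ _ = m≡m′
  ... | tri> _ _ m′<m = ⊥-elim (no-later-change m′<m m<n changes′ changes)

distinguishes⇒n≤k : ∀ {n k} (qs : Vec Digraph k) → Distinguishes qs (𝒟 n) (𝒟′ n) → n ≤ k
distinguishes⇒n≤k {n} {k} qs dist = injective⇒≤ changing-injective
  where
  consecutive-differ : ∀ {m} → m < n → profile qs D[ n , m ] ≢ profile qs D[ n , suc m ]
  consecutive-differ m<n with D-consecutive m<n
  ... | inj₁ (𝒟m , 𝒟′m+1) = dist 𝒟m 𝒟′m+1
  ... | inj₂ (𝒟′m , 𝒟m+1) = dist 𝒟m+1 𝒟′m ∘ sym
  witness : (j : Fin n) → Σ (Fin k) λ i → ChangesAt n (lookup qs i) (toℕ j)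
  witness j = ¬∀⟶∃¬ k _ (λ i → hom (lookup qs i) D[ n , m ] ℕ.≟ hom (lookup qs i) D[ n , suc m ])
    (consecutive-differ (toℕ<n j) ∘ profile-≡ qs D[ n , m ] D[ n , suc m ])
    where m = toℕ j
  changing : Fin n → Fin k
  changing = proj₁ ∘ witness
  changing-injective : ∀ {j j′} → changing j ≡ changing j′ → j ≡ j′
  changing-injective {j} {j′} same = toℕ-injective
    (changes-unique (lookup qs (changing j′)) (toℕ<n j) (toℕ<n j′)
      (subst (λ i → ChangesAt n (lookup qs i) (toℕ j)) same (proj₂ (witness j))) (proj₂ (witness j′)))

-- Upper bound

cycleQueries : (k : ℕ) → Vec Digraph k
cycleQueries k = tabulate (C[_] ∘ toℕ)

lookup-profile-cycleQueries : ∀ {k a} (a<k : a < k) D →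
  lookup (profile (cycleQueries k) D) (fromℕ< a<k) ≡ hom C[ a ] D
lookup-profile-cycleQueries {k} {a} a<k D = begin
  lookup (profile (cycleQueries k) D) i  ≡⟨ lookup-map i (λ F → hom F D) (cycleQueries k) ⟩
  hom (lookup (cycleQueries k) i) D      ≡⟨ cong (λ F → hom F D) (lookup∘tabulate (C[_] ∘ toℕ) i) ⟩
  hom C[ toℕ i ] D                       ≡⟨ cong (λ m → hom C[ m ] D) (toℕ-fromℕ< a<k) ⟩
  hom C[ a ] D                           ∎
  where
  open ≡-Reasoning
  i = fromℕ< a<k

module _ {n k : ℕ} (n≤k : n ≤ k) where

  cycleQueries-differ : ∀ {a b} → a < b → b ≤ n →
    profile (cycleQueries k) D[ n , a ] ≢ profile (cycleQueries k) D[ n , b ]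
  cycleQueries-differ {a} {b} a<b b≤n eq = C-hom≯0 a<b (subst (0 <_) (begin
    hom C[ a ] D[ n , a ]                           ≡⟨ lookup-profile-cycleQueries a<k D[ n , a ] ⟨
    lookup (profile (cycleQueries k) D[ n , a ]) i  ≡⟨ cong (λ v → lookup v i) eq ⟩
    lookup (profile (cycleQueries k) D[ n , b ]) i  ≡⟨ lookup-profile-cycleQueries a<k D[ n , b ] ⟩
    hom C[ a ] D[ n , b ]                           ∎) (C-hom>0 a))
    where
    open ≡-Reasoning
    a<k = <-≤-trans a<b (≤-trans b≤n n≤k)
    i = fromℕ< a<k

  cycleQueries-injective : ∀ {a b} → a ≤ n → b ≤ n →
    profile (cycleQueries k) D[ n , a ] ≡ profile (cycleQueries k) D[ n , b ] → a ≡ b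
  cycleQueries-injective {a} {b} a≤n b≤n eq with <-cmp a b
  ... | tri< a<b _ _ = ⊥-elim (cycleQueries-differ a<b b≤n eq)
  ... | tri≈ _ a≡b _ = a≡b
  ... | tri> _ _ b<a = ⊥-elim (cycleQueries-differ b<a a≤n (sym eq))

  cycleQueries-distinguishes : Distinguishes (cycleQueries k) (𝒟 n) (𝒟′ n)
  cycleQueries-distinguishes (a , a≤n , 2∣a , refl) (b , b≤n , 2∤b , refl) eq =
    2∤b (subst (2 ∣_) (cycleQueries-injective a≤n b≤n eq) 2∣a)

theorem13 : (n k : ℕ) → 0 < k →
    ((Σ (Algorithm k) λ A → Separates A (𝒟 n) (𝒟′ n)) → n ≤ k)
    × (n ≤ k → Σ (Algorithm k) λ A → Separates A (𝒟 n) (𝒟′ n))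
theorem13 n k _ =
  (λ (A , separates) → distinguishes⇒n≤k (queries A) (separates⇒distinguishes {A = A} separates)) ,
  (λ n≤k → distinguishes⇒separates (cycleQueries k) (cycleQueries-distinguishes n≤k))
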